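{- Let $G$ be a graph, $v$ a vertex of $G$ and $U=U_vG$. The map $\rho:U\to G$, $\rho([(vw_1\cdots w_{n-1}w_n)])=w_n$, is a homotopy covering map.
   Context: All graphs are undirected, have no multiple edges, may have loops, are connected, and are not a single isolated vertex. A walk is a sequence $(v_0\cdots v_n)$ with $v_i\sim v_{i+1}$; $N_2(x)$ is the set of walks of length 2 starting at $x$. A homotopy covering map is a morphism $f:\widetilde G\to G$ such that for each vertex $\tilde x$, applying $f$ vertexwise gives a bijection $N_2(\tilde x)\to N_2(f(\tilde x))$ respecting endpoints (two walks in $N_2(\tilde x)$ end at the same vertex iff their images do). A prune of a walk with $v_i=v_{i+2}$ replaces the segment $v_iv_{i+1}v_i$ by $v_i$; a spider move on $(v_0\cdots v_n)$ replaces one $v_i$, $0<i<n$, by $v_i'$ with $v_{i-1}\sim v_i'\sim v_{i+1}$; walks are equivalent if connected by finitely many prunes, inverse prunes and spider moves. $\Pi(G)$ is the groupoid of vertices and equivalence classes of walks under concatenation ($\alpha*\beta$ = $\alpha$ then $\beta$); $\Pi_v(G)$ is the set of arrows with source $v$. $U_vG$ is the graph whose vertices are the arrows of $\Pi_v(G)$, with $\alpha\sim\beta$ iff $\beta=\alpha*[(wx)]$ for an edge $w\sim x$ with $w$ the target of $\alpha$. -}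

module Defs where

open import Data.Product using (Σ; ∃; _×_; _,_; proj₁; Σ-syntax)
open import Relation.Binary.PropositionalEquality using (_≡_)
open import Relation.Binary.Construct.Closure.Equivalence using (EqClosure)
open import Function.Bundles using (_⇔_)

module _ {V : Set} (_~_ : V → V → Set) where
  infixr 5 _∷⟨_⟩_
  data Walk : V → V → Set where
    [_]     : (x : V) → Walk x x
    _∷⟨_⟩_ : ∀ {y z} (x : V) → x ~ y → Walk y z → Walk x z

-- A graph: undirected (symmetric adjacency), no multiple edges (adjacency is
-- proof-irrelevant, i.e. a relation), loops allowed, connected, and not a
-- single isolated vertex (it has at least one edge).
record Graph : Set₁ where
  field
    V         : Set
    _~_       : V → V → Set
    ~-sym     : ∀ {x y} → x ~ y → y ~ x
    ~-irr     : ∀ {x y} (p q : x ~ y) → p ≡ q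
    connected : ∀ x y → Walk _~_ x y
    hasEdge   : Σ[ x ∈ V ] Σ[ y ∈ V ] (x ~ y)

  W : V → V → Set
  W = Walk _~_

  _++_ : ∀ {x y z} → W x y → W y z → W x z
  [ x ] ++ β = β
  (x ∷⟨ p ⟩ α) ++ β = x ∷⟨ p ⟩ (α ++ β)

  data Step : ∀ {x z} → W x z → W x z → Set where
    prune  : ∀ {x y z} (p : x ~ y) (q : y ~ x) (w : W x z) →
             Step (x ∷⟨ p ⟩ y ∷⟨ q ⟩ w) w
    spider : ∀ {x y y' z t} (p : x ~ y) (q : y ~ z) (p' : x ~ y') (q' : y' ~ z)
             (w : W z t) →
             Step (x ∷⟨ p ⟩ y ∷⟨ q ⟩ w) (x ∷⟨ p' ⟩ y' ∷⟨ q' ⟩ w)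
    there  : ∀ {x y z} (p : x ~ y) {w w' : W y z} → Step w w' →
             Step (x ∷⟨ p ⟩ w) (x ∷⟨ p ⟩ w')

  _≃_ : ∀ {x z} → W x z → W x z → Set
  _≃_ = EqClosure Step

  -- Arrows of Π_v(G): walks from v (arrows are their ≃-classes; the quotient
  -- is presented as a setoid).
  Arrow : V → Set
  Arrow v = Σ[ w ∈ V ] W v w

  data _≈A_ {v : V} : Arrow v → Arrow v → Set where
    mk≈ : ∀ {w} {α β : W v w} → α ≃ β → (w , α) ≈A (w , β)

  -- adjacency in U_vG: [β] = [α] * [(w x)] for an edge w ~ x, w the target of α
  data _~U_ {v : V} : Arrow v → Arrow v → Set where
    mk~ : ∀ {w x} {α : W v w} {β : W v x} (e : w ~ x) →
          (α ++ (w ∷⟨ e ⟩ [ x ])) ≃ β → (w , α) ~U (x , β)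

  ρ : ∀ {v} → Arrow v → V
  ρ = proj₁


-- Homotopy covering map f from a graph H (vertices presented as a setoid
-- (Ṽ, _≈_) with adjacency _∼_) to a graph G.
record IsHomotopyCovering (G : Graph) {Ṽ : Set} (_≈_ : Ṽ → Ṽ → Set)
         (_∼_ : Ṽ → Ṽ → Set) (f : Ṽ → Graph.V G) : Set where
  open Graph G using (_~_)
  field
    resp≈    : ∀ {a b} → a ≈ b → f a ≡ f b
    morphism : ∀ {a b} → a ∼ b → f a ~ f b
    -- N₂(x̃) → N₂(f x̃), (x̃ ỹ z̃) ↦ (f x̃, f ỹ, f z̃), is injective
    inj      : ∀ {x y z y' z'} → x ∼ y → y ∼ z → x ∼ y' → y' ∼ z' →
               f y ≡ f y' → f z ≡ f z' → (y ≈ y') × (z ≈ z')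
    surj     : ∀ x {a b} → f x ~ a → a ~ b →
               Σ[ y ∈ Ṽ ] Σ[ z ∈ Ṽ ] (x ∼ y × y ∼ z × f y ≡ a × f z ≡ b)
    endpoints : ∀ {x y z y' z'} → x ∼ y → y ∼ z → x ∼ y' → y' ∼ z' →
               (z ≈ z') ⇔ (f z ≡ f z')

-- A vertex of U_vG is a walk from v up to equivalence, and its neighbours are its
-- one-edge extensions; so the lifts of a 2-walk (x a b) of G starting at [α] are
-- forced to be [α(x a)] and [α(x a)(a b)], which gives the bijection on N₂. Two
-- 2-walks of U_vG from [α] with the same image endpoint end at equivalent walks
-- because α(x a)(a b) and α(x a')(a' b) differ by a single spider move.
module Submission where

open import Defs
open import Data.Product using (_×_; _,_; Σ-syntax)
open import Relation.Binary.PropositionalEquality using (_≡_; refl; sym; cong)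
import Relation.Binary.Construct.Closure.Equivalence as EqClosure
import Relation.Binary.Reasoning.Setoid as SetoidReasoning
open import Relation.Binary.Bundles using (Setoid)
open import Level using (0ℓ)
open import Function.Bundles using (mk⇔)

module WalkProperties (G : Graph) where
  open Graph G

  edge : ∀ {x y} → x ~ y → W x y
  edge {x} {y} e = x ∷⟨ e ⟩ [ y ]

  ++-assoc : ∀ {x y z t} (α : W x y) (β : W y z) (γ : W z t) →
             (α ++ β) ++ γ ≡ α ++ (β ++ γ)
  ++-assoc [ x ]        β γ = refl
  ++-assoc (x ∷⟨ p ⟩ α) β γ = cong (x ∷⟨ p ⟩_) (++-assoc α β γ)

  Step-++ʳ : ∀ {x y z} (γ : W y z) {β β' : W x y} → Step β β' → Step (β ++ γ) (β' ++ γ)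
  Step-++ʳ γ (prune p q w)        = prune p q (w ++ γ)
  Step-++ʳ γ (spider p q p' q' w) = spider p q p' q' (w ++ γ)
  Step-++ʳ γ (there p s)          = there p (Step-++ʳ γ s)

  Step-++ˡ : ∀ {x y z} (α : W x y) {β β' : W y z} → Step β β' → Step (α ++ β) (α ++ β')
  Step-++ˡ [ x ]        s = s
  Step-++ˡ (x ∷⟨ p ⟩ α) s = there p (Step-++ˡ α s)

  ++-congʳ : ∀ {x y z} (γ : W y z) {β β' : W x y} → β ≃ β' → (β ++ γ) ≃ (β' ++ γ)
  ++-congʳ γ = EqClosure.gmap (_++ γ) (Step-++ʳ γ)

  ++-congˡ : ∀ {x y z} (α : W x y) {β β' : W y z} → β ≃ β' → (α ++ β) ≃ (α ++ β')
  ++-congˡ α = EqClosure.gmap (α ++_) (Step-++ˡ α)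

  ≃-setoid : V → V → Setoid 0ℓ 0ℓ
  ≃-setoid x z = EqClosure.setoid (Step {x} {z})

  spider-++ : ∀ {v x y y' z} (α : W v x) (p : x ~ y) (q : y ~ z) (p' : x ~ y') (q' : y' ~ z) →
              ((α ++ edge p) ++ edge q) ≃ ((α ++ edge p') ++ edge q')
  spider-++ {v} {z = z} α p q p' q' = begin
    (α ++ edge p) ++ edge q     ≡⟨ ++-assoc α (edge p) (edge q) ⟩
    α ++ (edge p ++ edge q)     ≈⟨ ++-congˡ α (EqClosure.return (spider p q p' q' [ z ])) ⟩
    α ++ (edge p' ++ edge q')   ≡⟨ sym (++-assoc α (edge p') (edge q')) ⟩
    (α ++ edge p') ++ edge q'   ∎
    where open SetoidReasoning (≃-setoid v z)

module UniversalCover (G : Graph) (v : Graph.V G) where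
  open Graph G
  open WalkProperties G

  ~U-unique-lift : ∀ {x y y' : Arrow v} → x ~U y → x ~U y' → ρ y ≡ ρ y' → y ≈A y'
  ~U-unique-lift (mk~ e α+e≃β) (mk~ e' α+e'≃β') refl rewrite ~-irr e e' =
    mk≈ (EqClosure.transitive Step (EqClosure.symmetric Step α+e≃β) α+e'≃β')

  ~U²-unique-end : ∀ {x y z y' z' : Arrow v} → x ~U y → y ~U z → x ~U y' → y' ~U z' →
                   ρ z ≡ ρ z' → z ≈A z'
  ~U²-unique-end {_ , α} {_ , β} {d , γ} {_ , β'} {_ , γ'}
                 (mk~ p α+p≃β) (mk~ q β+q≃γ) (mk~ p' α+p'≃β') (mk~ q' β'+q'≃γ') refl =
    mk≈ (begin
      γ                           ≈˘⟨ β+q≃γ ⟩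
      β ++ edge q                 ≈˘⟨ ++-congʳ (edge q) α+p≃β ⟩
      (α ++ edge p) ++ edge q     ≈⟨ spider-++ α p q p' q' ⟩
      (α ++ edge p') ++ edge q'   ≈⟨ ++-congʳ (edge q') α+p'≃β' ⟩
      β' ++ edge q'               ≈⟨ β'+q'≃γ' ⟩
      γ'                          ∎)
    where open SetoidReasoning (≃-setoid v d)

  lift-2-walk : ∀ (x : Arrow v) {a b} → ρ x ~ a → a ~ b →
                Σ[ y ∈ Arrow v ] Σ[ z ∈ Arrow v ] (x ~U y × y ~U z × ρ y ≡ a × ρ z ≡ b)
  lift-2-walk (_ , α) {a} {b} p q =
    (a , α ++ edge p) , (b , (α ++ edge p) ++ edge q) ,
    mk~ p (EqClosure.reflexive Step) , mk~ q (EqClosure.reflexive Step) , refl , refl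

  ρ-resp-≈A : ∀ {x y : Arrow v} → x ≈A y → ρ x ≡ ρ y
  ρ-resp-≈A (mk≈ _) = refl

  ρ-morphism : ∀ {x y : Arrow v} → x ~U y → ρ x ~ ρ y
  ρ-morphism (mk~ e _) = e

lemma3p16 : (G : Graph) (v : Graph.V G) →
    IsHomotopyCovering G (Graph._≈A_ G {v}) (Graph._~U_ G {v}) (Graph.ρ G {v})
lemma3p16 G v = record
  { resp≈     = ρ-resp-≈A
  ; morphism  = ρ-morphism
  ; inj       = λ xy yz xy' y'z' ρy≡ρy' ρz≡ρz' →
                  ~U-unique-lift xy xy' ρy≡ρy' , ~U²-unique-end xy yz xy' y'z' ρz≡ρz'
  ; surj      = lift-2-walk
  ; endpoints = λ xy yz xy' y'z' → mk⇔ ρ-resp-≈A (~U²-unique-end xy yz xy' y'z')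
  }
  where open UniversalCover G v
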